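{- For every $n\ge 2$, the set $U(n)=\{\boldsymbol{u}^1,\dots,\boldsymbol{u}^{n-1}\}\subset\mathbb{R}^n$ is an orthogonal set with respect to the standard dot product, i.e. $\boldsymbol{u}^j\cdot\boldsymbol{u}^k=0$ for $j\neq k$.
   Context: Definition of $\boldsymbol{w}(k)$ for integers $k\geq 2$: $\boldsymbol{w}(k)=(w(k)_0,\dots,w(k)_{k-1})$, where: if $k$ is odd, $w(k)_i=(k-1)/2$ for $i$ even and $w(k)_i=-(k+1)/2$ for $i$ odd; $\boldsymbol{w}(2)=(1,-1)$; $\boldsymbol{w}(4)=(1,-1,-1,1)$; if $k=2m$ is even with $k>4$, $w(k)_i=w(m)_{i \bmod m}$ for $0\le i\le k-1$. Definition of $U(n)$ for $n\ge 2$: build a rooted, vector-labeled binary tree $T_n$. The root is labeled $\boldsymbol{w}(n)\in\mathbb{R}^n$ (coordinates indexed $0,\dots,n-1$). For a vertex with label $\boldsymbol{u}$, let $i_0<\dots<i_{a'-1}$ be the indices $i$ with $u_i>0$ and $j_0<\dots<j_{a''-1}$ those with $u_j<0$. If $a'\ge2$, the vertex gets a left child labeled $\boldsymbol{u}'$ with $u'_{i_r}=w(a')_r$ ($0\le r\le a'-1$) and $u'_i=0$ otherwise. If $a''\ge 2$, it gets a right child labeled $\boldsymbol{u}''$ with $u''_{j_r}=w(a'')_r$ and $0$ otherwise. If $a'=a''=1$ the vertex is a leaf. $U(n)=\{\boldsymbol{u}^1,\dots,\boldsymbol{u}^{n-1}\}$, where $\boldsymbol{u}^i$ is the label of the $i$-th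 vertex visited in a depth-first (preorder) traversal of $T_n$, left child before right child. -}

module Defs where

open import Data.Nat.Base using (ℕ; zero; suc; _≡ᵇ_; _<ᵇ_; ⌊_/2⌋; _*_)
open import Data.Integer.Base using (ℤ; +_; -[1+_]; _+_; 0ℤ) renaming (_*_ to _*ℤ_)
open import Data.Integer.Base as ℤ using ()
open import Data.Bool.Base using (Bool; true; false; if_then_else_)
open import Data.List.Base using (List; []; _∷_; _++_; map; upTo; length; foldr; zipWith; filterᵇ)

-- Coordinates of a vector in ℝ^n are given as a list of n integers
-- (all labels in the construction are integer vectors).

isEven : ℕ → Bool
isEven k = (⌊ k /2⌋ * 2) ≡ᵇ k

wOddEntry : ℕ → ℕ → ℤ
wOddEntry k i = if isEven i then + ⌊ k /2⌋ else ℤ.- (+ suc ⌊ k /2⌋)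

-- w with an explicit fuel argument (fuel k suffices since k is halved
-- at each recursive step).  For k = 2m > 4, w(k)_i = w(m)_{i mod m},
-- i.e. w(k) = w(m) ++ w(m).
wFuel : ℕ → ℕ → List ℤ
wFuel zero    k = []
wFuel (suc f) k =
  if isEven k
  then (if k ≡ᵇ 2 then (+ 1 ∷ ℤ.- (+ 1) ∷ [])
        else if k ≡ᵇ 4 then (+ 1 ∷ ℤ.- (+ 1) ∷ ℤ.- (+ 1) ∷ + 1 ∷ [])
        else (wFuel f ⌊ k /2⌋ ++ wFuel f ⌊ k /2⌋))
  else map (wOddEntry k) (upTo k)

-- the vector w(k) (meaningful for k ≥ 2)
w : ℕ → List ℤ
w k = wFuel k k

isPos : ℤ → Bool
isPos (+ zero)  = false
isPos (+ suc _) = true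
isPos -[1+ _ ]  = false

isNeg : ℤ → Bool
isNeg (+ _)     = false
isNeg -[1+ _ ]  = true

place : (ℤ → Bool) → List ℤ → List ℤ → List ℤ
place p []       v = []
place p (x ∷ u) v with p x | v
... | true  | (y ∷ v') = y ∷ place p u v'
... | true  | []       = 0ℤ ∷ place p u []
... | false | v'       = 0ℤ ∷ place p u v'

count : (ℤ → Bool) → List ℤ → ℕ
count p u = length (filterᵇ p u)

-- preorder traversal of the subtree rooted at a vertex with label u
-- (left child before right child).  Fuel: the depth of T_n is < n.
preorder : ℕ → List ℤ → List (List ℤ)
preorder zero    u = []
preorder (suc f) u = u ∷ (leftPart ++ rightPart)
  where
  a′  = count isPos u
  a″ = count isNeg u
  leftPart  = if 1 <ᵇ a′  then preorder f (place isPos u (w a′))  else []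
  rightPart = if 1 <ᵇ a″ then preorder f (place isNeg u (w a″)) else []

U : ℕ → List (List ℤ)
U n = preorder n (w n)

dot : List ℤ → List ℤ → ℤ
dot u v = foldr _+_ 0ℤ (zipWith _*ℤ_ u v)

-- Every label u of the tree has coordinate sum 0, and all its positive
-- coordinates share one value c, all its negative coordinates one value d:
-- both hold for each w(k), and placing w(k) on a set of coordinates keeps
-- them.  A vertex in the left subtree of u is a vector of sum 0 supported on
-- the positive coordinates of u, so its dot product with u is c times its
-- sum, i.e. 0; likewise on the right with d.  Vertices in the left and right
-- subtrees of u have disjoint supports, hence are orthogonal as well.
module Submission where

open import Defs
open import Data.Nat.Base using (ℕ; _≤_)
open import Data.Integer.Base using (0ℤ)
open import Data.Fin.Base using (Fin)
open import Data.List.Base using (length; lookup)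
open import Relation.Binary.PropositionalEquality using (_≡_; _≢_)

open import Data.Nat.Base as ℕ using (zero; suc; ⌊_/2⌋; _≡ᵇ_; _<ᵇ_; s≤s⁻¹)
import Data.Nat.Properties as ℕ
open import Data.Integer.Base using (ℤ; +_; -[1+_]; _+_; -_; _*_)
import Data.Integer.Properties as ℤ
open import Data.Integer.Tactic.RingSolver using (solve-∀)
open import Data.Bool.Base using (Bool; true; false; if_then_else_; T; _∨_)
open import Data.List.Base using (List; []; _∷_; _++_; map; upTo; foldr)
import Data.List.Properties as List
open import Data.List.Membership.Propositional.Properties using (∈-lookup)
open import Data.List.Relation.Unary.All as All using (All; []; _∷_)
import Data.List.Relation.Unary.All.Properties as All
open import Data.List.Relation.Unary.AllPairs using (AllPairs; []; _∷_)
import Data.List.Relation.Unary.AllPairs.Properties as AllPairs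
open import Data.Fin.Base as Fin using ()
open import Data.Empty using (⊥; ⊥-elim)
open import Data.Unit using (tt)
open import Data.Product using (∃; _×_; _,_; proj₁)
open import Relation.Binary.Core using (Rel)
open import Relation.Binary.Definitions using (Symmetric)
open import Relation.Binary.PropositionalEquality using (refl; sym; trans; cong; cong₂; subst; module ≡-Reasoning)

sumℤ : List ℤ → ℤ
sumℤ = foldr _+_ 0ℤ

sumℤ-++ : ∀ xs ys → sumℤ (xs ++ ys) ≡ sumℤ xs + sumℤ ys
sumℤ-++ []       ys = sym (ℤ.+-identityˡ _)
sumℤ-++ (x ∷ xs) ys = trans (cong (_+_ x) (sumℤ-++ xs ys)) (sym (ℤ.+-assoc x _ _))

dot-comm : ∀ u v → dot u v ≡ dot v u
dot-comm []      []      = refl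
dot-comm []      (_ ∷ _) = refl
dot-comm (_ ∷ _) []      = refl
dot-comm (x ∷ u) (y ∷ v) = cong₂ _+_ (ℤ.*-comm x y) (dot-comm u v)

AllPairs-lookup : ∀ {a ℓ} {A : Set a} {R : Rel A ℓ} → Symmetric R →
                  ∀ {xs} → AllPairs R xs → (i j : Fin (length xs)) → i ≢ j →
                  R (lookup xs i) (lookup xs j)
AllPairs-lookup sym-R (_ ∷ _)  Fin.zero    Fin.zero    i≢j = ⊥-elim (i≢j refl)
AllPairs-lookup sym-R (x∼ ∷ _) Fin.zero    (Fin.suc j) i≢j = All.lookup x∼ (∈-lookup j)
AllPairs-lookup sym-R (x∼ ∷ _) (Fin.suc i) Fin.zero    i≢j = sym-R (All.lookup x∼ (∈-lookup i))
AllPairs-lookup sym-R (_ ∷ xs) (Fin.suc i) (Fin.suc j) i≢j =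
  AllPairs-lookup sym-R xs i j (λ i≡j → i≢j (cong Fin.suc i≡j))

isEven[t*2]≡true : ∀ t → isEven (t ℕ.* 2) ≡ true
isEven[t*2]≡true zero    = refl
isEven[t*2]≡true (suc t) = isEven[t*2]≡true t

isEven[1+t*2]≡false : ∀ t → isEven (suc (t ℕ.* 2)) ≡ false
isEven[1+t*2]≡false zero    = refl
isEven[1+t*2]≡false (suc t) = isEven[1+t*2]≡false t

≡ᵇ⇒≡ : ∀ {m n} → (m ≡ᵇ n) ≡ true → m ≡ n
≡ᵇ⇒≡ {m} {n} eq = ℕ.≡ᵇ⇒≡ m n (subst T (sym eq) tt)

isEven⇒⌊k/2⌋*2≡k : ∀ k → isEven k ≡ true → ⌊ k /2⌋ ℕ.* 2 ≡ k
isEven⇒⌊k/2⌋*2≡k k = ≡ᵇ⇒≡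

¬isEven⇒1+⌊k/2⌋*2≡k : ∀ k → isEven k ≡ false → suc (⌊ k /2⌋ ℕ.* 2) ≡ k
¬isEven⇒1+⌊k/2⌋*2≡k zero          ()
¬isEven⇒1+⌊k/2⌋*2≡k (suc zero)    _   = refl
¬isEven⇒1+⌊k/2⌋*2≡k (suc (suc k)) odd = cong (2 ℕ.+_) (¬isEven⇒1+⌊k/2⌋*2≡k k odd)

wOddPrefixSum : ℕ → ℕ → ℤ
wOddPrefixSum k j = sumℤ (map (wOddEntry k) (upTo j))

wOddPrefixSum-suc : ∀ k j → wOddPrefixSum k (suc j) ≡ wOddPrefixSum k j + wOddEntry k j
wOddPrefixSum-suc k j = begin
  sumℤ (map (wOddEntry k) (upTo (suc j)))                  ≡⟨ cong (λ is → sumℤ (map (wOddEntry k) is)) (sym (List.upTo-∷ʳ j)) ⟩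
  sumℤ (map (wOddEntry k) (upTo j ++ j ∷ []))              ≡⟨ cong sumℤ (List.map-++ (wOddEntry k) (upTo j) (j ∷ [])) ⟩
  sumℤ (map (wOddEntry k) (upTo j) ++ wOddEntry k j ∷ [])  ≡⟨ sumℤ-++ (map (wOddEntry k) (upTo j)) _ ⟩
  wOddPrefixSum k j + (wOddEntry k j + 0ℤ)                 ≡⟨ cong (_+_ (wOddPrefixSum k j)) (ℤ.+-identityʳ _) ⟩
  wOddPrefixSum k j + wOddEntry k j                        ∎
  where open ≡-Reasoning

wOddEntry-even : ∀ k t → wOddEntry k (t ℕ.* 2) ≡ + ⌊ k /2⌋
wOddEntry-even k t rewrite isEven[t*2]≡true t = refl

wOddEntry-odd : ∀ k t → wOddEntry k (suc (t ℕ.* 2)) ≡ - (+ 1 + + ⌊ k /2⌋)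
wOddEntry-odd k t rewrite isEven[1+t*2]≡false t = refl

wOddPrefixSum-even : ∀ k t → wOddPrefixSum k (t ℕ.* 2) ≡ - (+ t)
wOddPrefixSum-even k zero    = refl
wOddPrefixSum-even k (suc t) = begin
  wOddPrefixSum k (suc (suc (t ℕ.* 2)))
    ≡⟨ wOddPrefixSum-suc k (suc (t ℕ.* 2)) ⟩
  wOddPrefixSum k (suc (t ℕ.* 2)) + wOddEntry k (suc (t ℕ.* 2))
    ≡⟨ cong₂ _+_ (wOddPrefixSum-suc k (t ℕ.* 2)) (wOddEntry-odd k t) ⟩
  (wOddPrefixSum k (t ℕ.* 2) + wOddEntry k (t ℕ.* 2)) + - (+ 1 + + ⌊ k /2⌋)
    ≡⟨ cong (λ s → s + - (+ 1 + + ⌊ k /2⌋)) (cong₂ _+_ (wOddPrefixSum-even k t) (wOddEntry-even k t)) ⟩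
  (- (+ t) + + ⌊ k /2⌋) + - (+ 1 + + ⌊ k /2⌋)
    ≡⟨ telescope (+ t) (+ ⌊ k /2⌋) ⟩
  - (+ suc t) ∎
  where
  open ≡-Reasoning
  telescope : ∀ (a b : ℤ) → (- a + b) + - (+ 1 + b) ≡ - (+ 1 + a)
  telescope = solve-∀

wOddSum : ∀ k → isEven k ≡ false → wOddPrefixSum k k ≡ 0ℤ
wOddSum k odd = subst (λ j → wOddPrefixSum k j ≡ 0ℤ) (¬isEven⇒1+⌊k/2⌋*2≡k k odd) (begin
  wOddPrefixSum k (suc (⌊ k /2⌋ ℕ.* 2))                         ≡⟨ wOddPrefixSum-suc k (⌊ k /2⌋ ℕ.* 2) ⟩
  wOddPrefixSum k (⌊ k /2⌋ ℕ.* 2) + wOddEntry k (⌊ k /2⌋ ℕ.* 2)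
    ≡⟨ cong₂ _+_ (wOddPrefixSum-even k ⌊ k /2⌋) (wOddEntry-even k ⌊ k /2⌋) ⟩
  - (+ ⌊ k /2⌋) + + ⌊ k /2⌋                                      ≡⟨ ℤ.+-inverseˡ (+ ⌊ k /2⌋) ⟩
  0ℤ                                                             ∎)
  where open ≡-Reasoning

ConstantOn : (ℤ → Bool) → ℤ → List ℤ → Set
ConstantOn p c = All (λ x → T (p x) → x ≡ c)

SignConstant : List ℤ → Set
SignConstant u = ∃ (λ c → ConstantOn isPos c u) × ∃ (λ d → ConstantOn isNeg d u)

SignConstant-++ : ∀ u → SignConstant u → SignConstant (u ++ u)
SignConstant-++ u ((c , pos) , (d , neg)) = (c , All.++⁺ pos pos) , (d , All.++⁺ neg neg)

wOdd-signConstant : ∀ k is → SignConstant (map (wOddEntry k) is)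
wOdd-signConstant k is = (+ ⌊ k /2⌋ , pos is) , (-[1+ ⌊ k /2⌋ ] , neg is)
  where
  pos : ∀ is → ConstantOn isPos (+ ⌊ k /2⌋) (map (wOddEntry k) is)
  pos []       = []
  pos (i ∷ is) with isEven i
  ... | true  = (λ _ → refl) ∷ pos is
  ... | false = (λ ()) ∷ pos is
  neg : ∀ is → ConstantOn isNeg -[1+ ⌊ k /2⌋ ] (map (wOddEntry k) is)
  neg []       = []
  neg (i ∷ is) with isEven i
  ... | true  = (λ ()) ∷ neg is
  ... | false = (λ _ → refl) ∷ neg is

wFuel-signConstant : ∀ f k → SignConstant (wFuel f k)
wFuel-signConstant zero    k = (0ℤ , []) , (0ℤ , [])
wFuel-signConstant (suc f) k with isEven k
... | false = wOdd-signConstant k (upTo k)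
... | true with k ≡ᵇ 2
... | true = (+ 1 , (λ _ → refl) ∷ (λ ()) ∷ []) , (- (+ 1) , (λ ()) ∷ (λ _ → refl) ∷ [])
... | false with k ≡ᵇ 4
... | true = (+ 1 , (λ _ → refl) ∷ (λ ()) ∷ (λ ()) ∷ (λ _ → refl) ∷ [])
           , (- (+ 1) , (λ ()) ∷ (λ _ → refl) ∷ (λ _ → refl) ∷ (λ ()) ∷ [])
... | false = SignConstant-++ (wFuel f ⌊ k /2⌋) (wFuel-signConstant f ⌊ k /2⌋)

sumℤ-wFuel : ∀ f k → sumℤ (wFuel f k) ≡ 0ℤ
sumℤ-wFuel zero    k = refl
sumℤ-wFuel (suc f) k with isEven k in parity
... | false = wOddSum k parity
... | true with k ≡ᵇ 2
... | true = refl
... | false with k ≡ᵇ 4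
... | true = refl
... | false = trans (sumℤ-++ (wFuel f ⌊ k /2⌋) _) (cong₂ _+_ (sumℤ-wFuel f ⌊ k /2⌋) (sumℤ-wFuel f ⌊ k /2⌋))

length-wFuel : ∀ f k → k ≤ f → length (wFuel f k) ≡ k
length-wFuel zero    zero _    = refl
length-wFuel (suc f) k    k≤1+f with isEven k in parity
... | false = trans (List.length-map (wOddEntry k) (upTo k)) (List.length-upTo k)
... | true with k ≡ᵇ 2 in k≡2
... | true = sym (≡ᵇ⇒≡ k≡2)
... | false with k ≡ᵇ 4 in k≡4
... | true = sym (≡ᵇ⇒≡ k≡4)
... | false = begin
  length (wFuel f ⌊ k /2⌋ ++ wFuel f ⌊ k /2⌋)  ≡⟨ List.length-++ (wFuel f ⌊ k /2⌋) ⟩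
  length (wFuel f ⌊ k /2⌋) ℕ.+ length (wFuel f ⌊ k /2⌋)
    ≡⟨ cong₂ ℕ._+_ (length-wFuel f ⌊ k /2⌋ ⌊k/2⌋≤f) (length-wFuel f ⌊ k /2⌋ ⌊k/2⌋≤f) ⟩
  ⌊ k /2⌋ ℕ.+ ⌊ k /2⌋                          ≡⟨ cong (⌊ k /2⌋ ℕ.+_) (sym (ℕ.+-identityʳ ⌊ k /2⌋)) ⟩
  2 ℕ.* ⌊ k /2⌋                                ≡⟨ ℕ.*-comm 2 ⌊ k /2⌋ ⟩
  ⌊ k /2⌋ ℕ.* 2                                ≡⟨ isEven⇒⌊k/2⌋*2≡k k parity ⟩
  k                                            ∎
  where
  open ≡-Reasoning
  ⌊k/2⌋≤f : ⌊ k /2⌋ ≤ f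
  ⌊k/2⌋≤f = ℕ.≤-trans (ℕ.⌊n/2⌋-mono k≤1+f) (s≤s⁻¹ (ℕ.⌊n/2⌋<n f))

isNonZero : ℤ → Bool
isNonZero x = isPos x ∨ isNeg x

isPos⇒isNonZero : ∀ x → T (isPos x) → T (isNonZero x)
isPos⇒isNonZero (+ suc _) _ = tt

isNeg⇒isNonZero : ∀ x → T (isNeg x) → T (isNonZero x)
isNeg⇒isNonZero -[1+ _ ] _ = tt

data SupportedOn (p : ℤ → Bool) : List ℤ → List ℤ → Set where
  []   : SupportedOn p [] []
  zero : ∀ {x u v} → SupportedOn p u v → SupportedOn p (x ∷ u) (0ℤ ∷ v)
  hit  : ∀ {x y u v} → T (p x) → SupportedOn p u v → SupportedOn p (x ∷ u) (y ∷ v)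

supportedOn-refl : ∀ u → SupportedOn isNonZero u u
supportedOn-refl []             = []
supportedOn-refl (+ zero ∷ u)   = zero (supportedOn-refl u)
supportedOn-refl (+ suc _ ∷ u)  = hit tt (supportedOn-refl u)
supportedOn-refl (-[1+ _ ] ∷ u) = hit tt (supportedOn-refl u)

supportedOn-trans : ∀ {p u v v′} → SupportedOn p u v → SupportedOn isNonZero v v′ → SupportedOn p u v′
supportedOn-trans []           []           = []
supportedOn-trans (zero u→v)   (zero v→v′)  = zero (supportedOn-trans u→v v→v′)
supportedOn-trans (hit _ u→v)  (zero v→v′)  = zero (supportedOn-trans u→v v→v′)
supportedOn-trans (hit px u→v) (hit _ v→v′) = hit px (supportedOn-trans u→v v→v′)
supportedOn-trans (zero _)     (hit () _)

supportedOn-mono : ∀ {p q u v} → (∀ x → T (p x) → T (q x)) → SupportedOn p u v → SupportedOn q u v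
supportedOn-mono p⇒q []               = []
supportedOn-mono p⇒q (zero u→v)       = zero (supportedOn-mono p⇒q u→v)
supportedOn-mono p⇒q (hit {x} px u→v) = hit (p⇒q x px) (supportedOn-mono p⇒q u→v)

place-supportedOn : ∀ p u v → SupportedOn p u (place p u v)
place-supportedOn p []      v = []
place-supportedOn p (x ∷ u) v with p x in px | v
... | true  | y ∷ v′ = hit (subst T (sym px) tt) (place-supportedOn p u v′)
... | true  | []     = zero (place-supportedOn p u [])
... | false | v′     = zero (place-supportedOn p u v′)

place-constantOn : ∀ p q c u v → (T (q 0ℤ) → ⊥) → ConstantOn q c v → ConstantOn q c (place p u v)
place-constantOn p q c []      v ¬q0 const = []
place-constantOn p q c (x ∷ u) v ¬q0 const with p x | v | const
... | true  | y ∷ v′ | cy ∷ cv′ = cy ∷ place-constantOn p q c u v′ ¬q0 cv′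
... | true  | []     | []       = (λ q0 → ⊥-elim (¬q0 q0)) ∷ place-constantOn p q c u [] ¬q0 []
... | false | v′     | cv′      = (λ q0 → ⊥-elim (¬q0 q0)) ∷ place-constantOn p q c u v′ ¬q0 cv′

place-signConstant : ∀ p u v → SignConstant v → SignConstant (place p u v)
place-signConstant p u v ((c , pos) , (d , neg)) =
  (c , place-constantOn p isPos c u v (λ ()) pos) , (d , place-constantOn p isNeg d u v (λ ()) neg)

sumℤ-place : ∀ p u v → length v ≡ count p u → sumℤ (place p u v) ≡ sumℤ v
sumℤ-place p []      []      _   = refl
sumℤ-place p []      (_ ∷ _) ()
sumℤ-place p (x ∷ u) v       len with p x | v
... | true  | y ∷ v′ = cong (_+_ y) (sumℤ-place p u v′ (ℕ.suc-injective len))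
... | true  | []     = ⊥-elim (ℕ.0≢1+n len)
... | false | v′     = trans (ℤ.+-identityˡ _) (sumℤ-place p u v′ len)

dot-constantOn : ∀ {p c u v} → ConstantOn p c u → SupportedOn p u v → dot u v ≡ c * sumℤ v
dot-constantOn {c = c} []            []           = sym (ℤ.*-zeroʳ c)
dot-constantOn {c = c} {x ∷ u} {_ ∷ v} (_ ∷ const) (zero u→v) = begin
  x * 0ℤ + dot u v     ≡⟨ cong₂ _+_ (ℤ.*-zeroʳ x) (dot-constantOn const u→v) ⟩
  0ℤ + c * sumℤ v      ≡⟨ ℤ.+-identityˡ _ ⟩
  c * sumℤ v           ≡⟨ cong (c *_) (ℤ.+-identityˡ (sumℤ v)) ⟨
  c * (0ℤ + sumℤ v)    ∎
  where open ≡-Reasoning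
dot-constantOn {c = c} {x ∷ u} {y ∷ v} (x≡c ∷ const) (hit px u→v) = begin
  x * y + dot u v      ≡⟨ cong₂ _+_ (cong (_* y) (x≡c px)) (dot-constantOn const u→v) ⟩
  c * y + c * sumℤ v   ≡⟨ ℤ.*-distribˡ-+ c y (sumℤ v) ⟨
  c * (y + sumℤ v)     ∎
  where open ≡-Reasoning

dot-disjoint : ∀ {p q u v v′} → (∀ x → T (p x) → T (q x) → ⊥) →
               SupportedOn p u v → SupportedOn q u v′ → dot v v′ ≡ 0ℤ
dot-disjoint p∩q=∅ []         []         = refl
dot-disjoint p∩q=∅ (zero u→v) (zero u→v′) = trans (ℤ.+-identityˡ _) (dot-disjoint p∩q=∅ u→v u→v′)
dot-disjoint {v′ = y ∷ _} p∩q=∅ (zero u→v) (hit _ u→v′) =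
  cong₂ _+_ (ℤ.*-zeroˡ y) (dot-disjoint p∩q=∅ u→v u→v′)
dot-disjoint {v = y ∷ _} p∩q=∅ (hit _ u→v) (zero u→v′) =
  cong₂ _+_ (ℤ.*-zeroʳ y) (dot-disjoint p∩q=∅ u→v u→v′)
dot-disjoint {u = x ∷ _} p∩q=∅ (hit px _) (hit qx _) = ⊥-elim (p∩q=∅ x px qx)

isPos∩isNeg=∅ : ∀ x → T (isPos x) → T (isNeg x) → ⊥
isPos∩isNeg=∅ (+ suc _) _ ()

child : (ℤ → Bool) → List ℤ → List ℤ
child p u = place p u (w (count p u))

subtree : ℕ → (ℤ → Bool) → List ℤ → List (List ℤ)
subtree f p u = if 1 <ᵇ count p u then preorder f (child p u) else []

Admissible : List ℤ → Set
Admissible u = SignConstant u × sumℤ u ≡ 0ℤ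

w-admissible : ∀ k → Admissible (w k)
w-admissible k = wFuel-signConstant k k , sumℤ-wFuel k k

child-admissible : ∀ p u → Admissible (child p u)
child-admissible p u =
  place-signConstant p u (w a) (wFuel-signConstant a a) ,
  trans (sumℤ-place p u (w a) (length-wFuel a a ℕ.≤-refl)) (sumℤ-wFuel a a)
  where
  a : ℕ
  a = count p u

Orthogonal : List ℤ → List ℤ → Set
Orthogonal u v = dot u v ≡ 0ℤ

ZeroSumOn : (ℤ → Bool) → List ℤ → List ℤ → Set
ZeroSumOn p u v = SupportedOn p u v × sumℤ v ≡ 0ℤ

zeroSumOn-trans : ∀ {p u v v′} → SupportedOn p u v → ZeroSumOn isNonZero v v′ → ZeroSumOn p u v′
zeroSumOn-trans u→v (v→v′ , sum0) = supportedOn-trans u→v v→v′ , sum0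

zeroSumOn-mono : ∀ {p q u v} → (∀ x → T (p x) → T (q x)) → ZeroSumOn p u v → ZeroSumOn q u v
zeroSumOn-mono p⇒q (u→v , sum0) = supportedOn-mono p⇒q u→v , sum0

constantOn-orthogonal : ∀ {p c u v} → ConstantOn p c u → ZeroSumOn p u v → Orthogonal u v
constantOn-orthogonal {c = c} const (u→v , sum0) =
  trans (dot-constantOn const u→v) (trans (cong (c *_) sum0) (ℤ.*-zeroʳ c))

zeroSumOn-isPos-isNeg-orthogonal : ∀ {u v v′} → ZeroSumOn isPos u v → ZeroSumOn isNeg u v′ → Orthogonal v v′
zeroSumOn-isPos-isNeg-orthogonal (u→v , _) (u→v′ , _) = dot-disjoint isPos∩isNeg=∅ u→v u→v′

mutual
  preorder-orthogonal : ∀ f u → Admissible u →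
                        AllPairs Orthogonal (preorder f u) × All (ZeroSumOn isNonZero u) (preorder f u)
  preorder-orthogonal zero    u _ = [] , []
  preorder-orthogonal (suc f) u (((c , pos) , (d , neg)) , sum0)
    with subtree-orthogonal f isPos u | subtree-orthogonal f isNeg u
  ... | (L⊥ , L↓) | (R⊥ , R↓) =
    (u⊥subtrees ∷ AllPairs.++⁺ L⊥ R⊥ L⊥R) , ((supportedOn-refl u , sum0) ∷ subtrees↓)
    where
    L R : List (List ℤ)
    L = subtree f isPos u
    R = subtree f isNeg u
    u⊥subtrees : All (Orthogonal u) (L ++ R)
    u⊥subtrees = All.++⁺ (All.map (constantOn-orthogonal pos) L↓) (All.map (constantOn-orthogonal neg) R↓)
    L⊥R : All (λ l → All (Orthogonal l) R) L
    L⊥R = All.map (λ l↓ → All.map (zeroSumOn-isPos-isNeg-orthogonal l↓) R↓) L↓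
    subtrees↓ : All (ZeroSumOn isNonZero u) (L ++ R)
    subtrees↓ = All.++⁺ (All.map (zeroSumOn-mono isPos⇒isNonZero) L↓) (All.map (zeroSumOn-mono isNeg⇒isNonZero) R↓)

  subtree-orthogonal : ∀ f p u → AllPairs Orthogonal (subtree f p u) × All (ZeroSumOn p u) (subtree f p u)
  subtree-orthogonal f p u with 1 <ᵇ count p u
  ... | false = [] , []
  ... | true with preorder-orthogonal f (child p u) (child-admissible p u)
  ...   | ⊥s , ↓s = ⊥s , All.map (zeroSumOn-trans (place-supportedOn p u _)) ↓s

proposition3p4 : (n : ℕ) → 2 ≤ n → (j k : Fin (length (U n))) → j ≢ k → dot (lookup (U n) j) (lookup (U n) k) ≡ 0ℤ
proposition3p4 n _ = AllPairs-lookup (λ {u} {v} u⊥v → trans (dot-comm v u) u⊥v)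
                       (proj₁ (preorder-orthogonal n (w n) (w-admissible n)))
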